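{- For every $i\in V$, every $j\in N(i)$ and every $u_i\in L$, \[ f_i(u_i)\ge p\,g_i(u_i)+\min_{u_j\in L}\Big(p\,h_{ij}(u_i,u_j)+q\,f_j(u_j)\Big), \] and for every $i\in V$ and $u_i\in L$, \[ f_i(u_i)\ge p\,g_i(u_i)+\sum_{j\in N(i)}w_{ij}\min_{u_j\in L}\Big(p\,h_{ij}(u_i,u_j)+q\,f_j(u_j)\Big). \]
   Context: Let $G=(V,E)$ be an undirected, simple, connected graph with $V=\{1,\dots,n\}$, $n\ge 2$. For $i\in V$ let $N(i)=\{j\in V:\{i,j\}\in E\}$. Let $L$ be a finite set of labels. For each $i\in V$ let $g_i:L\to[0,\infty)$, and for each $\{i,j\}\in E$ let $h_{ij},h_{ji}:L^2\to[0,\infty)$ with $h_{ij}(a,b)=h_{ji}(b,a)$. The energy $F:L^V\to\mathbb R$ is $F(x)=\sum_{i\in V}g_i(x_i)+\sum_{\{i,j\}\in E}h_{ij}(x_i,x_j)$, and the value functions (max-marginals) are $f_i(\tau)=\min\{F(x): x\in L^V,\ x_i=\tau\}$ for $i\in V$, $\tau\in L$. Fix $p\in(0,1)$, $q=1-p$, and weights $w_{ij}\in[0,1]$ for $i\in V$, $j\in N(i)$, with $\sum_{j\in N(i)}w_{ij}=1$ for every $i\in V$. -}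

module Defs where

open import Level using (Level; _⊔_) renaming (suc to lsuc)
open import Algebra.Bundles using (CommutativeRing)
open import Relation.Binary.Structures using (IsTotalOrder)
open import Data.Nat using (ℕ; zero; suc; _<ᵇ_)
open import Data.Fin using (Fin; zero; suc; toℕ)
open import Data.Bool using (Bool; true; false; if_then_else_; _∧_)
open import Data.Product using (Σ; _×_; _,_)
open import Relation.Binary.PropositionalEquality using (_≡_)
open import Relation.Nullary using (¬_)

-- A (linearly) ordered commutative ring.  The real numbers are an instance;
-- the statement is formulated over an arbitrary such structure.
record OrderedCommRing (c ℓ₁ ℓ₂ : Level) : Set (lsuc (c ⊔ ℓ₁ ⊔ ℓ₂)) where
  field
    commutativeRing : CommutativeRing c ℓ₁
  open CommutativeRing commutativeRing public
  infix 4 _≤_ _<_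
  field
    _≤_          : Carrier → Carrier → Set ℓ₂
    isTotalOrder : IsTotalOrder _≈_ _≤_
    +-mono-≤     : ∀ {x y} z → x ≤ y → (x + z) ≤ (y + z)
    *-nonneg     : ∀ {x y} → 0# ≤ x → 0# ≤ y → 0# ≤ (x * y)

  _<_ : Carrier → Carrier → Set (ℓ₁ ⊔ ℓ₂)
  x < y = (x ≤ y) × ¬ (x ≈ y)

IsSimpleGraph : ∀ {n} → (Fin n → Fin n → Bool) → Set
IsSimpleGraph {n} adj = (∀ i j → adj i j ≡ adj j i) × (∀ i → adj i i ≡ false)

data Reach {n} (adj : Fin n → Fin n → Bool) : Fin n → Fin n → Set where
  here : ∀ {i} → Reach adj i i
  step : ∀ {i k j} → adj i k ≡ true → Reach adj k j → Reach adj i j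

Connected : ∀ {n} → (Fin n → Fin n → Bool) → Set
Connected {n} adj = ∀ i j → Reach adj i j

module Over {c ℓ₁ ℓ₂} (R : OrderedCommRing c ℓ₁ ℓ₂) where
  open OrderedCommRing R using (Carrier; _≈_; _≤_; _+_; 0#)

  sumFin : (n : ℕ) → (Fin n → Carrier) → Carrier
  sumFin zero    φ = 0#
  sumFin (suc n) φ = φ zero + sumFin n (λ i → φ (suc i))

  nbrSum : ∀ {n} → (Fin n → Fin n → Bool) → Fin n → (Fin n → Carrier) → Carrier
  nbrSum {n} adj i φ = sumFin n (λ j → if adj i j then φ j else 0#)

  -- F(x) = Σ_i g_i(x_i) + Σ_{{i,j} ∈ E} h_ij(x_i,x_j)   (each edge counted once, as i < j)
  energy : ∀ {n k} → (Fin n → Fin n → Bool) → (Fin n → Fin k → Carrier)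
         → (Fin n → Fin n → Fin k → Fin k → Carrier) → (Fin n → Fin k) → Carrier
  energy {n} adj g h x =
    sumFin n (λ i → g i (x i)) +
    sumFin n (λ i → sumFin n (λ j →
      if adj i j ∧ (toℕ i <ᵇ toℕ j) then h i j (x i) (x j) else 0#))

  IsMin : ∀ {a ℓ} {A : Set a} → (A → Carrier) → (A → Set ℓ) → Carrier → Set (a ⊔ ℓ ⊔ ℓ₁ ⊔ ℓ₂)
  IsMin {A = A} φ P m = Σ A (λ a → P a × (φ a ≈ m)) × (∀ a → P a → m ≤ φ a)

-- Let x be a labelling attaining f_i(u_i), so F(x) = f_i(u_i) and x_i = u_i.
-- Because all potentials are non-negative, for every neighbour j of i the
-- energy dominates the two terms g_i(x_i) + h_ij(x_i,x_j), and it also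
-- dominates f_j(x_j), since x is a labelling with label x_j at j.  Splitting
-- F(x) = p F(x) + q F(x) gives
--   f_i(u_i) ≥ p g_i(u_i) + p h_ij(u_i,x_j) + q f_j(x_j) ≥ p g_i(u_i) + m_ij,
-- which is the first inequality.  The second follows by averaging the first
-- over the neighbours of i with the convex weights w_ij.

module Submission where

open import Defs
open import Data.Nat using (ℕ; zero; suc; _<ᵇ_) renaming (_≤_ to _≤ℕ_)
open import Data.Nat.Properties using (<⇒<ᵇ)
open import Data.Fin using (Fin; zero; suc; toℕ) renaming (_<_ to _<F_)
open import Data.Fin.Properties using (<-cmp)
open import Data.Bool using (Bool; true; false; if_then_else_; _∧_)
open import Data.Bool.Properties using (T-≡)
open import Data.Product using (_×_; _,_; proj₁; proj₂)
open import Data.Unit using (⊤; tt)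
open import Function.Bundles using (Equivalence)
open import Relation.Binary.PropositionalEquality
  using (_≡_) renaming (refl to ≡-refl; sym to ≡-sym; trans to ≡-trans)
open import Relation.Binary.Structures using (IsTotalOrder; IsPartialOrder)
open import Relation.Binary.Bundles using (Poset)
open import Relation.Binary.Definitions using (tri<; tri≈; tri>)
open import Relation.Nullary using (contradiction)
import Algebra.Properties.Group as GroupProperties
import Relation.Binary.Reasoning.Setoid as SetoidReasoning
import Relation.Binary.Reasoning.PartialOrder as PosetReasoning

module OrderedRingFacts {c ℓ₁ ℓ₂} (R : OrderedCommRing c ℓ₁ ℓ₂) where
  open OrderedCommRing R hiding (zero)
  open IsTotalOrder isTotalOrder public
    using (isPartialOrder) renaming (trans to ≤-trans; reflexive to ≤-reflexive)
  open IsPartialOrder isPartialOrder public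
    using () renaming (≤-respˡ-≈ to ≤-respˡ; ≤-respʳ-≈ to ≤-respʳ)
  open GroupProperties +-group using (//-rightDividesˡ; //-rightDividesʳ)

  poset : Poset c ℓ₁ ℓ₂
  poset = record { isPartialOrder = isPartialOrder }

  ≤-refl : ∀ {x} → x ≤ x
  ≤-refl = ≤-reflexive refl

  +-monoʳ-≤ : ∀ {x y} z → x ≤ y → z + x ≤ z + y
  +-monoʳ-≤ {x} {y} z x≤y = ≤-respʳ (+-comm y z) (≤-respˡ (+-comm x z) (+-mono-≤ z x≤y))

  +-mono₂-≤ : ∀ {a b c d} → a ≤ b → c ≤ d → a + c ≤ b + d
  +-mono₂-≤ {b = b} {c = c} a≤b c≤d = ≤-trans (+-mono-≤ c a≤b) (+-monoʳ-≤ b c≤d)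

  x≤y⇒0≤y-x : ∀ {x y} → x ≤ y → 0# ≤ y - x
  x≤y⇒0≤y-x {x} le = ≤-respˡ (-‿inverseʳ x) (+-mono-≤ (- x) le)

  +-residual : ∀ {a m b} → a + m ≤ b → m ≤ b - a
  +-residual {a} {m} a+m≤b =
    ≤-respˡ (trans (+-cong (+-comm a m) refl) (//-rightDividesʳ a m)) (+-mono-≤ (- a) a+m≤b)

  *-monoˡ-≤ : ∀ {x y z} → 0# ≤ z → x ≤ y → z * x ≤ z * y
  *-monoˡ-≤ {x} {y} {z} 0≤z x≤y =
    ≤-respʳ scaled-split
      (≤-respˡ (+-identityʳ (z * x)) (+-monoʳ-≤ (z * x) (*-nonneg 0≤z (x≤y⇒0≤y-x x≤y))))
    where
    scaled-split : z * x + z * (y - x) ≈ z * y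
    scaled-split = trans (sym (distribˡ z x (y - x)))
                         (*-cong refl (trans (+-comm x (y - x)) (//-rightDividesˡ x y)))

  convex-split : ∀ p E → p * E + (1# - p) * E ≈ E
  convex-split p E = begin
      p * E + (1# - p) * E  ≈⟨ distribʳ E p (1# - p) ⟨
      (p + (1# - p)) * E    ≈⟨ *-cong (+-comm p (1# - p)) refl ⟩
      ((1# - p) + p) * E    ≈⟨ *-cong (//-rightDividesˡ p 1#) refl ⟩
      1# * E                ≈⟨ *-identityˡ E ⟩
      E                     ∎
    where open SetoidReasoning setoid

module FiniteSums {c ℓ₁ ℓ₂} (R : OrderedCommRing c ℓ₁ ℓ₂) where
  open OrderedCommRing R hiding (zero)
  open Over R
  open OrderedRingFacts R

  sumFin-cong : ∀ n {φ ψ : Fin n → Carrier} → (∀ j → φ j ≈ ψ j) → sumFin n φ ≈ sumFin n ψ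
  sumFin-cong zero    φ≈ψ = refl
  sumFin-cong (suc n) φ≈ψ = +-cong (φ≈ψ zero) (sumFin-cong n (λ j → φ≈ψ (suc j)))

  sumFin-mono : ∀ n {φ ψ : Fin n → Carrier} → (∀ j → φ j ≤ ψ j) → sumFin n φ ≤ sumFin n ψ
  sumFin-mono zero    φ≤ψ = ≤-refl
  sumFin-mono (suc n) φ≤ψ = +-mono₂-≤ (φ≤ψ zero) (sumFin-mono n (λ j → φ≤ψ (suc j)))

  sumFin-*ʳ : ∀ n (φ : Fin n → Carrier) D → sumFin n (λ j → φ j * D) ≈ sumFin n φ * D
  sumFin-*ʳ zero    φ D = sym (zeroˡ D)
  sumFin-*ʳ (suc n) φ D =
    trans (+-cong refl (sumFin-*ʳ n (λ j → φ (suc j)) D)) (sym (distribʳ D (φ zero) _))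

  sumFin-nonneg : ∀ n {φ : Fin n → Carrier} → (∀ j → 0# ≤ φ j) → 0# ≤ sumFin n φ
  sumFin-nonneg zero    0≤φ = ≤-refl
  sumFin-nonneg (suc n) 0≤φ =
    ≤-respˡ (+-identityˡ 0#) (+-mono₂-≤ (0≤φ zero) (sumFin-nonneg n (λ j → 0≤φ (suc j))))

  term≤sumFin : ∀ n (φ : Fin n → Carrier) → (∀ j → 0# ≤ φ j) → ∀ a → φ a ≤ sumFin n φ
  term≤sumFin (suc n) φ 0≤φ zero =
    ≤-respˡ (+-identityʳ (φ zero)) (+-monoʳ-≤ (φ zero) (sumFin-nonneg n (λ j → 0≤φ (suc j))))
  term≤sumFin (suc n) φ 0≤φ (suc a) =
    ≤-respˡ (+-identityˡ (φ (suc a)))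
      (+-mono₂-≤ (0≤φ zero) (term≤sumFin n (λ j → φ (suc j)) (λ j → 0≤φ (suc j)) a))

  convex-average≤ : ∀ {n} (adj : Fin n → Fin n → Bool) i (w m : Fin n → Carrier) D →
    (∀ j → adj i j ≡ true → 0# ≤ w j) → (∀ j → adj i j ≡ true → m j ≤ D) →
    nbrSum adj i w ≈ 1# → nbrSum adj i (λ j → w j * m j) ≤ D
  convex-average≤ {n} adj i w m D 0≤w m≤D Σw≈1 = begin
      nbrSum adj i (λ j → w j * m j)               ≤⟨ sumFin-mono n weighted≤ ⟩
      nbrSum adj i (λ j → w j * D)                 ≈⟨ sumFin-cong n (λ j → if-*ʳ (adj i j)) ⟩
      sumFin n (λ j → (if adj i j then w j else 0#) * D)
                                                   ≈⟨ sumFin-*ʳ n _ D ⟩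
      nbrSum adj i w * D                           ≈⟨ *-cong Σw≈1 refl ⟩
      1# * D                                       ≈⟨ *-identityˡ D ⟩
      D                                            ∎
    where
    open PosetReasoning poset

    weighted≤ : ∀ j → (if adj i j then w j * m j else 0#) ≤ (if adj i j then w j * D else 0#)
    weighted≤ j with adj i j in e
    ... | true  = *-monoˡ-≤ (0≤w j e) (m≤D j e)
    ... | false = ≤-refl

    if-*ʳ : ∀ {a} b → (if b then a * D else 0#) ≈ (if b then a else 0#) * D
    if-*ʳ true  = refl
    if-*ʳ false = sym (zeroˡ D)

module EnergyBounds {c ℓ₁ ℓ₂} (R : OrderedCommRing c ℓ₁ ℓ₂) {n k : ℕ}
  (adj : Fin n → Fin n → Bool) (simple : IsSimpleGraph adj)
  (g : Fin n → Fin k → OrderedCommRing.Carrier R)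
  (g-nonneg : ∀ i a → OrderedCommRing._≤_ R (OrderedCommRing.0# R) (g i a))
  (h : Fin n → Fin n → Fin k → Fin k → OrderedCommRing.Carrier R)
  (h-nonneg : ∀ i j a b → adj i j ≡ true → OrderedCommRing._≤_ R (OrderedCommRing.0# R) (h i j a b))
  (h-sym : ∀ i j a b → adj i j ≡ true → OrderedCommRing._≈_ R (h i j a b) (h j i b a))
  (x : Fin n → Fin k) where
  open OrderedCommRing R hiding (zero)
  open Over R
  open OrderedRingFacts R
  open FiniteSums R

  pairTerm : Fin n → Fin n → Carrier
  pairTerm a b = if adj a b ∧ (toℕ a <ᵇ toℕ b) then h a b (x a) (x b) else 0#

  pairTerm-nonneg : ∀ a b → 0# ≤ pairTerm a b
  pairTerm-nonneg a b with adj a b in e | toℕ a <ᵇ toℕ b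
  ... | true  | true  = h-nonneg a b (x a) (x b) e
  ... | true  | false = ≤-refl
  ... | false | _     = ≤-refl

  pairTerm-edge : ∀ {a b} → adj a b ≡ true → a <F b → pairTerm a b ≡ h a b (x a) (x b)
  pairTerm-edge {a} {b} e a<b rewrite e | Equivalence.to T-≡ (<⇒<ᵇ a<b) = ≡-refl

  edgeSum : Carrier
  edgeSum = sumFin n (λ a → sumFin n (pairTerm a))

  pairTerm≤edgeSum : ∀ a b → pairTerm a b ≤ edgeSum
  pairTerm≤edgeSum a b =
    ≤-trans (term≤sumFin n (pairTerm a) (pairTerm-nonneg a) b)
            (term≤sumFin n (λ a → sumFin n (pairTerm a)) (λ a → sumFin-nonneg n (pairTerm-nonneg a)) a)

  -- Each edge, counted once in the energy in whichever orientation has the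
  -- smaller endpoint first, is below the edge part (using symmetry of h);
  -- the case i = j is excluded because the graph has no loops.
  edge≤edgeSum : ∀ i j → adj i j ≡ true → h i j (x i) (x j) ≤ edgeSum
  edge≤edgeSum i j e with <-cmp i j
  ... | tri< i<j _ _   = ≤-respˡ (reflexive (pairTerm-edge e i<j)) (pairTerm≤edgeSum i j)
  ... | tri≈ _ ≡-refl _ = contradiction (≡-trans (≡-sym e) (proj₂ simple i)) λ ()
  ... | tri> _ _ j<i   =
    ≤-respˡ (trans (reflexive (pairTerm-edge e′ j<i)) (sym (h-sym i j (x i) (x j) e)))
            (pairTerm≤edgeSum j i)
    where e′ : adj j i ≡ true
          e′ = ≡-trans (proj₁ simple j i) e

  energy≥vertex+edge : ∀ i j → adj i j ≡ true → g i (x i) + h i j (x i) (x j) ≤ energy adj g h x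
  energy≥vertex+edge i j e =
    +-mono₂-≤ (term≤sumFin n (λ a → g a (x a)) (λ a → g-nonneg a (x a)) i) (edge≤edgeSum i j e)

module MaxMarginalBounds {c ℓ₁ ℓ₂} (R : OrderedCommRing c ℓ₁ ℓ₂) {n k : ℕ}
  (adj : Fin n → Fin n → Bool) (simple : IsSimpleGraph adj)
  (g : Fin n → Fin k → OrderedCommRing.Carrier R)
  (g-nonneg : ∀ i a → OrderedCommRing._≤_ R (OrderedCommRing.0# R) (g i a))
  (h : Fin n → Fin n → Fin k → Fin k → OrderedCommRing.Carrier R)
  (h-nonneg : ∀ i j a b → adj i j ≡ true → OrderedCommRing._≤_ R (OrderedCommRing.0# R) (h i j a b))
  (h-sym : ∀ i j a b → adj i j ≡ true → OrderedCommRing._≈_ R (h i j a b) (h j i b a))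
  (f : Fin n → Fin k → OrderedCommRing.Carrier R)
  (f-min : ∀ i τ → Over.IsMin R (Over.energy R adj g h) (λ x → x i ≡ τ) (f i τ))
  (p : OrderedCommRing.Carrier R)
  (0≤p : OrderedCommRing._≤_ R (OrderedCommRing.0# R) p)
  (p≤1 : OrderedCommRing._≤_ R p (OrderedCommRing.1# R)) where
  open OrderedCommRing R hiding (zero)
  open Over R
  open OrderedRingFacts R
  open FiniteSums R

  q : Carrier
  q = 1# - p

  message : Fin n → Fin n → Fin k → Fin k → Carrier
  message i j ui uj = p * h i j ui uj + q * f j uj

  neighbour-bound : ∀ i j → adj i j ≡ true → ∀ ui m →
    IsMin (message i j ui) (λ _ → ⊤) m → p * g i ui + m ≤ f i ui
  neighbour-bound i j e ui m (_ , m≤message) with f-min i ui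
  ... | (x , ≡-refl , Fx≈fi) , _ = begin
      p * g i (x i) + m
        ≤⟨ +-monoʳ-≤ (p * g i (x i)) (m≤message (x j) tt) ⟩
      p * g i (x i) + (p * h i j (x i) (x j) + q * f j (x j))
        ≈⟨ +-assoc _ _ _ ⟨
      (p * g i (x i) + p * h i j (x i) (x j)) + q * f j (x j)
        ≈⟨ +-cong (distribˡ p _ _) refl ⟨
      p * (g i (x i) + h i j (x i) (x j)) + q * f j (x j)
        ≤⟨ +-mono₂-≤ (*-monoˡ-≤ 0≤p (energy≥vertex+edge i j e)) (*-monoˡ-≤ 0≤q fj≤Fx) ⟩
      p * energy adj g h x + q * energy adj g h x
        ≈⟨ convex-split p _ ⟩
      energy adj g h x
        ≈⟨ Fx≈fi ⟩
      f i (x i) ∎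
    where
    open PosetReasoning poset
    open EnergyBounds R adj simple g g-nonneg h h-nonneg h-sym x using (energy≥vertex+edge)

    0≤q : 0# ≤ q
    0≤q = x≤y⇒0≤y-x p≤1

    -- x is one of the labellings competing for f_j(x_j).
    fj≤Fx : f j (x j) ≤ energy adj g h x
    fj≤Fx = proj₂ (f-min j (x j)) x ≡-refl

  averaged-bound : ∀ (w : Fin n → Fin n → Carrier) →
    (∀ i j → adj i j ≡ true → 0# ≤ w i j) → (∀ i → nbrSum adj i (w i) ≈ 1#) →
    ∀ i ui (m : Fin n → Carrier) →
    (∀ j → adj i j ≡ true → IsMin (message i j ui) (λ _ → ⊤) (m j)) →
    p * g i ui + nbrSum adj i (λ j → w i j * m j) ≤ f i ui
  averaged-bound w 0≤w Σw≈1 i ui m m-min =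
    ≤-respʳ (//-rightDividesˡ (p * g i ui) (f i ui))
      (≤-respˡ (+-comm _ _)
        (+-mono-≤ (p * g i ui)
          (convex-average≤ adj i (w i) m _ (0≤w i) m≤slack (Σw≈1 i))))
    where
    open GroupProperties +-group using (//-rightDividesˡ)

    m≤slack : ∀ j → adj i j ≡ true → m j ≤ f i ui - p * g i ui
    m≤slack j e = +-residual (neighbour-bound i j e ui (m j) (m-min j e))

proposition2 : ∀ {c ℓ₁ ℓ₂} (R : OrderedCommRing c ℓ₁ ℓ₂) →
  let open OrderedCommRing R
      open Over R
  in
  (n k : ℕ) → 2 ≤ℕ n →
  (adj : Fin n → Fin n → Bool) → IsSimpleGraph adj → Connected adj →
  (g : Fin n → Fin k → Carrier) → (∀ i a → 0# ≤ g i a) →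
  (h : Fin n → Fin n → Fin k → Fin k → Carrier) →
  (∀ i j a b → adj i j ≡ true → 0# ≤ h i j a b) →
  (∀ i j a b → adj i j ≡ true → h i j a b ≈ h j i b a) →
  (f : Fin n → Fin k → Carrier) →
  (∀ i τ → IsMin (energy adj g h) (λ x → x i ≡ τ) (f i τ)) →
  (p : Carrier) → 0# < p → p < 1# →
  (w : Fin n → Fin n → Carrier) →
  (∀ i j → adj i j ≡ true → (0# ≤ w i j) × (w i j ≤ 1#)) →
  (∀ i → nbrSum adj i (w i) ≈ 1#) →
  let q = 1# - p in
  (∀ i j → adj i j ≡ true → ∀ ui → (m : Carrier) →
     IsMin (λ uj → p * h i j ui uj + q * f j uj) (λ _ → ⊤) m →
     p * g i ui + m ≤ f i ui)
  ×
  (∀ i ui → (m : Fin n → Carrier) →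
     (∀ j → adj i j ≡ true → IsMin (λ uj → p * h i j ui uj + q * f j uj) (λ _ → ⊤) (m j)) →
     p * g i ui + nbrSum adj i (λ j → w i j * m j) ≤ f i ui)
proposition2 R n k _ adj simple _ g g-nonneg h h-nonneg h-sym f f-min p 0<p p<1 w w-bounds Σw≈1 =
  neighbour-bound , averaged-bound w (λ i j e → proj₁ (w-bounds i j e)) Σw≈1
  where
  open MaxMarginalBounds R adj simple g g-nonneg h h-nonneg h-sym f f-min p (proj₁ 0<p) (proj₁ p<1)
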